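{- On a string $B$ of length at most $n$, the depth of the recursive calls of $\mathrm{Process}$ (in the decomposition algorithm described in the context) is at most $L=\lceil\log_{3/2}n\rceil+3$.
   Context: Alphabets: $|\Sigma|\le n^3$; $\Sigma_c=\{\mathtt c_1,\dots,\mathtt c_{Ln^4}\}$, $\Sigma_r=\{\mathtt r_{a,r}: a\in\Sigma\cup\Sigma_c,\ r\in\{2,\dots,n\}\}$, $\Gamma=\Sigma\cup\Sigma_c\cup\Sigma_r$, $\#\notin\Gamma$; $\Sigma^\ell_c=\{\mathtt c_i:(\ell-1)n^4<i\le\ell n^4\}$; $R=\log^*|\Gamma|+20$. $C_\ell:\Gamma^2\to\Sigma^\ell_c$ and $H_\ell:\Gamma^2\to\{0,1\}$ are given functions. Coloring: $F_{\mathrm{CVL}}:\Gamma^*\to\{1,2,3\}^*$ fixed, such that for $z$ without two equal consecutive symbols: length preserved; $i$-th output depends only on positions $i-R,\dots,i+R$; no two equal consecutive outputs; among any three consecutive outputs one is 1; output $3$ if $|z|=1$, else starts with 1 and ends with 2 or 3. $\mathrm{Compress}(B,\ell)$ ($|B|\ge2$): write $B=B_1\cdots B_m$, $m$ minimal, each maximal run $a^r$ ($r\ge2$) a block; $B'_i=\mathtt r_{a,r}\#$ (colored 1,2) for a run, else $B'_i=B_i$ colored by $F_{\mathrm{CVL}}(B_i)$; $B'=B'_1\cdots B'_m$. With empty output and $i=1$, while $i<|B'|$: if $B'[i+1]=\#$ append $B'[i]$ else append $C_\ell(B'[i]B'[i+1])$; $i\leftarrow i+2$; if $i\le|B'|$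 and $B'[i]$ not colored 1, append $B'[i]$, $i\leftarrow i+1$. $\mathrm{Split}(B,\ell)$: cut $B$ before every position $i\in\{2,\dots,|B|-1\}$ with $H_\ell(B[i]B[i+1])=0$; return the blocks in order. $\mathrm{Process}(B,\ell)$: if $|B|\le2$, output a grammar for $B$ and stop; otherwise compute $A=\mathrm{Compress}(B,\ell)$ and call $\mathrm{Process}(\cdot,\ell+1)$ on each block of $\mathrm{Split}(A,\ell)$. The decomposition algorithm calls $\mathrm{Process}(B,1)$ on each block of $\mathrm{Split}(x,0)$. -}

module Defs where

open import Data.Nat using (ℕ; zero; suc; _+_; _*_; _^_; _≤_; _<_)
import Data.Nat as N
open import Data.Bool using (Bool; true; false; if_then_else_)
open import Data.List using (List; []; _∷_; _++_; length; zip; [_])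
open import Data.List.Relation.Unary.All using (All)
open import Data.List.Relation.Unary.Linked using (Linked)
open import Data.Product using (_×_; _,_; proj₁; proj₂; ∃; Σ)
open import Data.Sum using (_⊎_)
open import Relation.Binary.PropositionalEquality using (_≡_; refl; cong; cong₂)
open import Relation.Nullary using (¬_; Dec; yes; no)

-- One ambient type containing Γ = Σ ∪ Σ_c ∪ Σ_r and #.
--   sig k     : the k-th letter of Σ   (Σ = {sig k : k < σ})
--   cc i      : c_i                    (Σ_c = {cc i : 1 ≤ i ≤ L n^4})
--   rr a r    : r_{a,r}
--   hash      : #

data Sym : Set where
  sig  : ℕ → Sym
  cc   : ℕ → Sym
  rr   : Sym → ℕ → Sym
  hash : Sym

_≟S_ : (a b : Sym) → Dec (a ≡ b)
sig m ≟S sig k with m N.≟ k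
... | yes refl = yes refl
... | no ne = no λ { refl → ne refl }
sig _ ≟S cc _ = no λ ()
sig _ ≟S rr _ _ = no λ ()
sig _ ≟S hash = no λ ()
cc _ ≟S sig _ = no λ ()
cc m ≟S cc k with m N.≟ k
... | yes refl = yes refl
... | no ne = no λ { refl → ne refl }
cc _ ≟S rr _ _ = no λ ()
cc _ ≟S hash = no λ ()
rr _ _ ≟S sig _ = no λ ()
rr _ _ ≟S cc _ = no λ ()
rr a r ≟S rr b s with a ≟S b | r N.≟ s
... | yes refl | yes refl = yes refl
... | no ne | _ = no λ { refl → ne refl }
... | yes _ | no ne = no λ { refl → ne refl }
rr _ _ ≟S hash = no λ ()
hash ≟S sig _ = no λ ()
hash ≟S cc _ = no λ ()
hash ≟S rr _ _ = no λ ()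
hash ≟S hash = yes refl

isHash : Sym → Bool
isHash hash = true
isHash _    = false

InΣ : ℕ → Sym → Set
InΣ σ a = Σ ℕ λ k → (k < σ) × (a ≡ sig k)

InΣc : (n L : ℕ) → Sym → Set
InΣc n L a = Σ ℕ λ i → (1 ≤ i) × (i ≤ L * n ^ 4) × (a ≡ cc i)

InΣcℓ : (n ℓ : ℕ) → Sym → Set
InΣcℓ n ℓ a = Σ ℕ λ i → (N.pred ℓ * n ^ 4 < i) × (i ≤ ℓ * n ^ 4) × (a ≡ cc i)

InΣr : (σ n L : ℕ) → Sym → Set
InΣr σ n L a = Σ Sym λ b → Σ ℕ λ r →
  (InΣ σ b ⊎ InΣc n L b) × (2 ≤ r) × (r ≤ n) × (a ≡ rr b r)

InΓ : (σ n L : ℕ) → Sym → Set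
InΓ σ n L a = InΣ σ a ⊎ (InΣc n L a ⊎ InΣr σ n L a)

data Col : Set where
  c1 c2 c3 : Col

isOne : Col → Bool
isOne c1 = true
isOne _  = false

NoRep : {A : Set} → List A → Set
NoRep = Linked (λ a b → ¬ (a ≡ b))

IsCVL : (List Sym → List Col) → Set
IsCVL F = (z : List Sym) → NoRep z →
    (length (F z) ≡ length z)
  × NoRep (F z)
  × ((xs ys : List Col) (a b c : Col) → F z ≡ xs ++ a ∷ b ∷ c ∷ ys →
        (a ≡ c1) ⊎ ((b ≡ c1) ⊎ (c ≡ c1)))
  × (length z ≡ 1 → F z ≡ [ c3 ])
  × (2 ≤ length z →
        (Σ (List Col) λ t → F z ≡ c1 ∷ t)
      × (Σ (List Col) λ t → (F z ≡ t ++ [ c2 ]) ⊎ (F z ≡ t ++ [ c3 ])))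

rle : List Sym → List (Sym × ℕ)
rle [] = []
rle (a ∷ xs) with rle xs
... | [] = (a , 1) ∷ []
... | (b , k) ∷ rest with a ≟S b
...   | yes _ = (b , suc k) ∷ rest
...   | no _  = (a , 1) ∷ (b , k) ∷ rest

-- blocks B_1 ⋯ B_m with m minimal: maximal runs of length ≥ 2 are
-- blocks, maximal stretches in between form the remaining blocks
data Block : Set where
  runB   : Sym → ℕ → Block
  plainB : List Sym → Block

toBlocks : List (Sym × ℕ) → List Block
toBlocks [] = []
toBlocks ((a , suc zero) ∷ rest) with toBlocks rest
... | plainB p ∷ bs = plainB (a ∷ p) ∷ bs
... | bs = plainB (a ∷ []) ∷ bs
toBlocks ((a , k) ∷ rest) = runB a k ∷ toBlocks rest

blocks : List Sym → List Block
blocks B = toBlocks (rle B)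

block' : (List Sym → List Col) → Block → List (Sym × Col)
block' F (runB a r) = (rr a r , c1) ∷ (hash , c2) ∷ []
block' F (plainB p) = zip p (F p)

concatMap' : {A B : Set} → (A → List B) → List A → List B
concatMap' f [] = []
concatMap' f (x ∷ xs) = f x ++ concatMap' f xs

B′ : (List Sym → List Col) → List Sym → List (Sym × Col)
B′ F B = concatMap' (block' F) (blocks B)

-- the pairing loop (i is the head of the list)
pairOut : (C : ℕ → Sym → Sym → Sym) → ℕ → Sym × Col → Sym × Col → Sym
pairOut C ℓ (x , _) (y , _) = if isHash y then x else C ℓ x y

loop : (C : ℕ → Sym → Sym → Sym) → ℕ → List (Sym × Col) → List Sym
loop C ℓ [] = []
loop C ℓ (x ∷ []) = []
loop C ℓ (x ∷ y ∷ []) = pairOut C ℓ x y ∷ []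
loop C ℓ (x ∷ y ∷ rest@(z ∷ rest′)) =
  pairOut C ℓ x y ∷
    (if isOne (proj₂ z) then loop C ℓ rest else proj₁ z ∷ loop C ℓ rest′)

Compress : (F : List Sym → List Col) (C : ℕ → Sym → Sym → Sym) →
           List Sym → ℕ → List Sym
Compress F C B ℓ = loop C ℓ (B′ F B)

-- Split (H ℓ a b ≡ false plays the role of H_ℓ(ab) = 0)

-- elements of the argument all sit at positions ≥ 2 of the original
-- string; returns (part before the first cut , blocks starting at cuts)
splitTail : (H : ℕ → Sym → Sym → Bool) → ℕ → List Sym →
            List Sym × List (List Sym)
splitTail H ℓ [] = [] , []
splitTail H ℓ (x ∷ []) = x ∷ [] , []
splitTail H ℓ (x ∷ rest@(y ∷ r)) with splitTail H ℓ rest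
... | p , bs = if H ℓ x y then (x ∷ p , bs) else ([] , (x ∷ p) ∷ bs)

Split : (H : ℕ → Sym → Sym → Bool) → List Sym → ℕ → List (List Sym)
Split H [] ℓ = []
Split H (a ∷ s) ℓ with splitTail H ℓ s
... | p , bs = (a ∷ p) ∷ bs

-- ProcessDepth≤ F C H d ℓ B : the call Process(B, ℓ) terminates and
-- the nesting depth of the calls it generates (itself counted as 1)
-- is at most d; i.e. every recursive call Process(·, ℓ') made has
-- ℓ' ≤ ℓ + d - 1.

data ProcessDepth≤ (F : List Sym → List Col) (C : ℕ → Sym → Sym → Sym)
                   (H : ℕ → Sym → Sym → Bool) : ℕ → ℕ → List Sym → Set where
  stop : ∀ {d ℓ B} → length B ≤ 2 → ProcessDepth≤ F C H (suc d) ℓ B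
  recurse : ∀ {d ℓ B} → 2 < length B →
            All (ProcessDepth≤ F C H d (suc ℓ)) (Split H (Compress F C B ℓ) ℓ) →
            ProcessDepth≤ F C H (suc d) ℓ B

-- k = ⌈log_{3/2} n⌉ : the least k with n ≤ (3/2)^k, i.e. n·2^k ≤ 3^k

IsCeilLog3/2 : ℕ → ℕ → Set
IsCeilLog3/2 n k = (n * 2 ^ k ≤ 3 ^ k) × ((j : ℕ) → n * 2 ^ j ≤ 3 ^ j → k ≤ j)

{-# OPTIONS --safe #-}
-- Each round of Process shrinks the string by a factor 2/3: B′ is no longer
-- than B (a run a^r, r ≥ 2, becomes the two symbols r_{a,r} #), and the
-- pairing loop emits at most two symbols for every three it reads, since a
-- symbol is only copied after a pair has been emitted.  Split never
-- lengthens a block.  Hence a string of length at most n ≤ (3/2)^k has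
-- length at most 2 after k rounds, and the call at depth k + 1 stops.
module Submission where

open import Defs
open import Data.Nat using (ℕ; zero; suc; _+_; _*_; _^_; _≤_; z≤n; s≤s; _≤?_)
open import Data.Nat.Properties
open import Data.Bool using (Bool; true; false)
open import Data.List using (List; []; _∷_; length; map)
open import Data.Nat.ListAction using (sum)
open import Data.List.Properties using (length-++; length-zipWith)
open import Data.List.Relation.Unary.All using (All; []; _∷_)
import Data.List.Relation.Unary.All as All
open import Data.Product using (_×_; _,_; proj₁; proj₂)
open import Relation.Binary.PropositionalEquality using (_≡_; refl; cong; subst; sym)
open import Relation.Nullary using (yes; no)
open import Function using (_∘_)
open import Algebra.Properties.CommutativeSemigroup *-commutativeSemigroup
  using (x∙yz≈y∙xz; xy∙z≈y∙xz)

sum-map-proj₂-rle : ∀ xs → sum (map proj₂ (rle xs)) ≡ length xs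
sum-map-proj₂-rle [] = refl
sum-map-proj₂-rle (a ∷ xs) with rle xs | sum-map-proj₂-rle xs
... | [] | eq = cong suc eq
... | (b , k) ∷ rest | eq with a ≟S b
...   | yes _ = cong suc eq
...   | no _  = cong suc eq

rle-positive : ∀ xs → All (λ p → 1 ≤ proj₂ p) (rle xs)
rle-positive [] = []
rle-positive (a ∷ xs) with rle xs | rle-positive xs
... | [] | _ = s≤s z≤n ∷ []
... | (b , k) ∷ rest | p ∷ ps with a ≟S b
...   | yes _ = s≤s z≤n ∷ ps
...   | no _  = s≤s z≤n ∷ p ∷ ps

blockLength : Block → ℕ
blockLength (runB _ _) = 2
blockLength (plainB p) = length p

-- Positivity matters: a run (a , 0) would become a block of length 2.
sum-blockLength-toBlocks : ∀ rs → All (λ p → 1 ≤ proj₂ p) rs →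
  sum (map blockLength (toBlocks rs)) ≤ sum (map proj₂ rs)
sum-blockLength-toBlocks [] [] = z≤n
sum-blockLength-toBlocks ((a , suc zero) ∷ rest) (_ ∷ ps)
  with toBlocks rest | sum-blockLength-toBlocks rest ps
... | []            | ih = s≤s ih
... | runB _ _ ∷ _  | ih = s≤s ih
... | plainB _ ∷ _  | ih = s≤s ih
sum-blockLength-toBlocks ((a , suc (suc k)) ∷ rest) (_ ∷ ps) =
  +-mono-≤ (s≤s (s≤s z≤n)) (sum-blockLength-toBlocks rest ps)

length-block′ : ∀ F b → length (block' F b) ≤ blockLength b
length-block′ F (runB _ _) = ≤-refl
length-block′ F (plainB p) =
  subst (_≤ length p) (sym (length-zipWith _,_ p (F p))) (m⊓n≤m _ _)

length-concatMap′ : {A B : Set} (f : A → List B) (g : A → ℕ) →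
  (∀ x → length (f x) ≤ g x) → ∀ xs → length (concatMap' f xs) ≤ sum (map g xs)
length-concatMap′ f g f≤g [] = z≤n
length-concatMap′ f g f≤g (x ∷ xs) =
  subst (_≤ g x + sum (map g xs)) (sym (length-++ (f x)))
    (+-mono-≤ (f≤g x) (length-concatMap′ f g f≤g xs))

length-B′ : ∀ F B → length (B′ F B) ≤ length B
length-B′ F B = begin
  length (B′ F B)                          ≤⟨ length-concatMap′ (block' F) blockLength (length-block′ F) (blocks B) ⟩
  sum (map blockLength (blocks B))         ≤⟨ sum-blockLength-toBlocks (rle B) (rle-positive B) ⟩
  sum (map proj₂ (rle B))                  ≡⟨ sum-map-proj₂-rle B ⟩
  length B                                 ∎
  where open ≤-Reasoning

loop-shrinks : ∀ C ℓ xs → 3 * length (loop C ℓ xs) ≤ 2 * length xs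
loop-shrinks C ℓ [] = z≤n
loop-shrinks C ℓ (x ∷ []) = z≤n
loop-shrinks C ℓ (x ∷ y ∷ []) = s≤s (s≤s (s≤s z≤n))
loop-shrinks C ℓ (x ∷ y ∷ zs@(z ∷ rest))
  with isOne (proj₂ z) | loop-shrinks C ℓ zs | loop-shrinks C ℓ rest
... | true | ih | _ = begin
  3 * suc m              ≡⟨ *-suc 3 m ⟩
  3 + 3 * m              ≤⟨ +-monoʳ-≤ 3 ih ⟩
  3 + 2 * suc r          ≡⟨ cong (3 +_) (*-suc 2 r) ⟩
  5 + 2 * r              ≤⟨ n≤1+n _ ⟩
  6 + 2 * r              ≡⟨ sym (*-distribˡ-+ 2 3 r) ⟩
  2 * (3 + r)            ∎
  where
  open ≤-Reasoning
  m = length (loop C ℓ zs)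
  r = length rest
... | false | _ | ih = begin
  3 * (2 + m)            ≡⟨ *-distribˡ-+ 3 2 m ⟩
  6 + 3 * m              ≤⟨ +-monoʳ-≤ 6 ih ⟩
  6 + 2 * r              ≡⟨ sym (*-distribˡ-+ 2 3 r) ⟩
  2 * (3 + r)            ∎
  where
  open ≤-Reasoning
  m = length (loop C ℓ rest)
  r = length rest

Compress-shrinks : ∀ F C B ℓ → 3 * length (Compress F C B ℓ) ≤ 2 * length B
Compress-shrinks F C B ℓ =
  ≤-trans (loop-shrinks C ℓ (B′ F B)) (*-monoʳ-≤ 2 (length-B′ F B))

splitTail-length : ∀ H ℓ s →
  length (proj₁ (splitTail H ℓ s)) ≤ length s ×
  All (λ b → length b ≤ length s) (proj₂ (splitTail H ℓ s))
splitTail-length H ℓ [] = z≤n , []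
splitTail-length H ℓ (x ∷ []) = s≤s z≤n , []
splitTail-length H ℓ (x ∷ rest@(y ∷ _))
  with splitTail H ℓ rest | splitTail-length H ℓ rest
... | p , bs | p≤ , bs≤ with H ℓ x y
...   | true  = s≤s p≤ , All.map m≤n⇒m≤1+n bs≤
...   | false = z≤n , (s≤s p≤ ∷ All.map m≤n⇒m≤1+n bs≤)

Split-length : ∀ H A ℓ → All (λ b → length b ≤ length A) (Split H A ℓ)
Split-length H [] ℓ = []
Split-length H (a ∷ s) ℓ with splitTail H ℓ s | splitTail-length H ℓ s
... | p , bs | p≤ , bs≤ = s≤s p≤ ∷ All.map m≤n⇒m≤1+n bs≤

-- |B|·2^j ≤ 2·3^j is |B| ≤ 2·(3/2)^j without fractions.
shrink-invariant : ∀ a b j → 3 * a ≤ 2 * b →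
  b * 2 ^ suc j ≤ 2 * 3 ^ suc j → a * 2 ^ j ≤ 2 * 3 ^ j
shrink-invariant a b j 3a≤2b hb = *-cancelˡ-≤ 3 (begin
  3 * (a * 2 ^ j)        ≡⟨ sym (*-assoc 3 a (2 ^ j)) ⟩
  (3 * a) * 2 ^ j        ≤⟨ *-monoˡ-≤ (2 ^ j) 3a≤2b ⟩
  (2 * b) * 2 ^ j        ≡⟨ xy∙z≈y∙xz 2 b (2 ^ j) ⟩
  b * (2 * 2 ^ j)        ≤⟨ hb ⟩
  2 * (3 * 3 ^ j)        ≡⟨ x∙yz≈y∙xz 2 3 (3 ^ j) ⟩
  3 * (2 * 3 ^ j)        ∎)
  where open ≤-Reasoning

module _ (F : List Sym → List Col) (C : ℕ → Sym → Sym → Sym)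
         (H : ℕ → Sym → Sym → Bool) where

  processDepth : ∀ j d ℓ B → length B * 2 ^ j ≤ 2 * 3 ^ j →
    ProcessDepth≤ F C H (suc j + d) ℓ B
  processDepth zero d ℓ B hB = stop (subst (_≤ 2) (*-identityʳ (length B)) hB)
  processDepth (suc j) d ℓ B hB with length B ≤? 2
  ... | yes |B|≤2 = stop |B|≤2
  ... | no |B|≰2 = recurse (≰⇒> |B|≰2)
    (All.map (λ {b} → processDepth j d (suc ℓ) b ∘ invariant b) (Split-length H A ℓ))
    where
    A = Compress F C B ℓ
    invariant : ∀ b → length b ≤ length A → length b * 2 ^ j ≤ 2 * 3 ^ j
    invariant b b≤A = shrink-invariant (length b) (length B) j
      (≤-trans (*-monoʳ-≤ 3 b≤A) (Compress-shrinks F C B ℓ)) hB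

corollary1 : (n σ k : ℕ) → σ ≤ n ^ 3 → IsCeilLog3/2 n k →
    (F : List Sym → List Col) → IsCVL F →
    (C : ℕ → Sym → Sym → Sym) →
    ((ℓ : ℕ) (a b : Sym) → 1 ≤ ℓ → ℓ ≤ k + 3 →
    InΓ σ n (k + 3) a → InΓ σ n (k + 3) b → InΣcℓ n ℓ (C ℓ a b)) →
    (H : ℕ → Sym → Sym → Bool) →
    (B : List Sym) → All (InΣ σ) B → length B ≤ n →
    ProcessDepth≤ F C H (k + 3) 1 B
corollary1 n σ k _ (n2^k≤3^k , _) F _ C _ H B _ |B|≤n =
  subst (λ d → ProcessDepth≤ F C H d 1 B) (sym (+-suc k 2))
    (processDepth F C H k 2 1 B (begin
      length B * 2 ^ k   ≤⟨ *-monoˡ-≤ (2 ^ k) |B|≤n ⟩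
      n * 2 ^ k          ≤⟨ n2^k≤3^k ⟩
      3 ^ k              ≤⟨ m≤n*m (3 ^ k) 2 ⟩
      2 * 3 ^ k          ∎))
  where open ≤-Reasoning
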